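{- Let $\mathcal{S}=(\mathscr{X},\nabla_{\mathcal{S}})$ be a non-commutative spacetime, $\mathscr{Y}$ a quantale, and $f:\mathscr{X}\to\mathscr{Y}$ a strict geometric embedding with a left adjoint $f_!:\mathscr{Y}\to\mathscr{X}$, and let $\mathcal{T}=(\mathscr{Y},\nabla)$ with $\nabla=f\circ\nabla_{\mathcal{S}}\circ f_!$ (this is the non-commutative spacetime making $f:\mathcal{S}\to\mathcal{T}$ a logical morphism). If $\mathcal{S}$ satisfies $(F)$, then so does $\mathcal{T}$; and if $\mathcal{S}$ satisfies $(wF)$, then so does $\mathcal{T}$.
   Context: A quantale is a poset with a monoid $(\otimes,e)$, $\otimes$ monotone, having all joins, with $\otimes$ distributing over arbitrary joins on both sides; it has a least element $0$. A non-commutative spacetime is $(\mathscr{X},\nabla)$ with $\mathscr{X}$ a quantale and $\nabla$ join preserving with $\nabla e\leq e$ and $\nabla(a\otimes b)\leq\nabla a\otimes\nabla b$. A strict geometric embedding is a join preserving map with $f(e)=e$, $f(a\otimes b)=f(a)\otimes f(b)$ which is an order embedding. $f_!$ being left adjoint to $f$ means $f_!(y)\leq x$ iff $y\leq f(x)$. A non-commutative spacetime satisfies $(F)$ if $a\leq\nabla a$ for all $a$, and $(wF)$ if $\nabla a=0$ implies $a=0$. -}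

module Defs where

open import Level using (Level; suc; _⊔_)
open import Data.Empty.Polymorphic using (⊥)
open import Data.Product using (_×_)
open import Relation.Binary.PropositionalEquality using (_≡_)
open import Function using (_∘_)

record Quantale (c ℓ ι : Level) : Set (suc (c ⊔ ℓ ⊔ ι)) where
  infix 4 _≤_
  infixl 7 _⊗_
  field
    Carrier   : Set c
    _≤_       : Carrier → Carrier → Set ℓ
    ≤-refl    : ∀ {a} → a ≤ a
    ≤-trans   : ∀ {a b d} → a ≤ b → b ≤ d → a ≤ d
    ≤-antisym : ∀ {a b} → a ≤ b → b ≤ a → a ≡ b
    ⋁         : {I : Set ι} → (I → Carrier) → Carrier
    ⋁-upper   : {I : Set ι} (g : I → Carrier) (i : I) → g i ≤ ⋁ g
    ⋁-least   : {I : Set ι} (g : I → Carrier) (b : Carrier) →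
                ((i : I) → g i ≤ b) → ⋁ g ≤ b
    _⊗_       : Carrier → Carrier → Carrier
    e         : Carrier
    ⊗-assoc   : ∀ a b d → (a ⊗ b) ⊗ d ≡ a ⊗ (b ⊗ d)
    ⊗-identityˡ : ∀ a → e ⊗ a ≡ a
    ⊗-identityʳ : ∀ a → a ⊗ e ≡ a
    ⊗-mono    : ∀ {a a′ b b′} → a ≤ a′ → b ≤ b′ → a ⊗ b ≤ a′ ⊗ b′
    ⊗-distribˡ-⋁ : ∀ a {I : Set ι} (g : I → Carrier) → a ⊗ ⋁ g ≡ ⋁ (λ i → a ⊗ g i)
    ⊗-distribʳ-⋁ : ∀ a {I : Set ι} (g : I → Carrier) → ⋁ g ⊗ a ≡ ⋁ (λ i → g i ⊗ a)

  𝟘 : Carrier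
  𝟘 = ⋁ {I = ⊥} (λ ())

module _ {c₁ ℓ₁ c₂ ℓ₂ ι : Level} (X : Quantale c₁ ℓ₁ ι) (Y : Quantale c₂ ℓ₂ ι) where
  private
    module X = Quantale X
    module Y = Quantale Y

  JoinPreserving : (X.Carrier → Y.Carrier) → Set (c₁ ⊔ c₂ ⊔ suc ι)
  JoinPreserving f = {I : Set ι} (g : I → X.Carrier) → f (X.⋁ g) ≡ Y.⋁ (f ∘ g)

  record IsStrictGeometricEmbedding (f : X.Carrier → Y.Carrier)
         : Set (c₁ ⊔ c₂ ⊔ ℓ₁ ⊔ ℓ₂ ⊔ suc ι) where
    field
      join-preserving : JoinPreserving f
      preserves-e     : f X.e ≡ Y.e
      preserves-⊗     : ∀ a b → f (a X.⊗ b) ≡ f a Y.⊗ f b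
      order-embedding : ∀ a b → (a X.≤ b → f a Y.≤ f b) × (f a Y.≤ f b → a X.≤ b)

  IsLeftAdjoint : (Y.Carrier → X.Carrier) → (X.Carrier → Y.Carrier) → Set (c₁ ⊔ c₂ ⊔ ℓ₁ ⊔ ℓ₂)
  IsLeftAdjoint f! f = ∀ y x → (f! y X.≤ x → y Y.≤ f x) × (y Y.≤ f x → f! y X.≤ x)

record IsSpacetime {c ℓ ι : Level} (X : Quantale c ℓ ι) (∇ : Quantale.Carrier X → Quantale.Carrier X)
       : Set (c ⊔ ℓ ⊔ suc ι) where
  open Quantale X
  field
    ∇-join : JoinPreserving X X ∇
    ∇-e    : ∇ e ≤ e
    ∇-⊗    : ∀ a b → ∇ (a ⊗ b) ≤ ∇ a ⊗ ∇ b

module _ {c ℓ ι : Level} (X : Quantale c ℓ ι) where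
  open Quantale X
  SatisfiesF : (Carrier → Carrier) → Set (c ⊔ ℓ)
  SatisfiesF ∇ = ∀ a → a ≤ ∇ a
  SatisfiesWF : (Carrier → Carrier) → Set c
  SatisfiesWF ∇ = ∀ a → ∇ a ≡ 𝟘 → a ≡ 𝟘

module Submission where

-- Only three elementary facts are involved:
--   * in a quantale the empty join 𝟘 is the least element, so every
--     join preserving map sends 𝟘 to 𝟘;
--   * the unit of the adjunction f! ⊣ f gives  y ≤ f (f! y);
--   * an order embedding reflects being 𝟘.
-- (F):  y ≤ f (f! y) ≤ f (∇S (f! y)), using (F) for S at f! y and
--       monotonicity of f.
-- (wF): if f (∇S (f! y)) = 𝟘 then ∇S (f! y) = 𝟘 (f reflects 𝟘), hence
--       f! y = 𝟘 by (wF) for S, and so y ≤ f (f! y) = f 𝟘 = 𝟘.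

open import Defs
open import Level using (Level)
open import Data.Empty.Polymorphic using (⊥)
open import Data.Product using (_×_; _,_; proj₁; proj₂)
open import Function using (_∘_)
open import Relation.Binary.PropositionalEquality using (_≡_; sym; trans; cong; subst)

module QuantaleBottom {c ℓ ι : Level} (Q : Quantale c ℓ ι) where
  open Quantale Q

  𝟘-least : ∀ a → 𝟘 ≤ a
  𝟘-least a = ⋁-least {I = ⊥} (λ ()) a (λ ())

  ≤𝟘⇒≡𝟘 : ∀ {a} → a ≤ 𝟘 → a ≡ 𝟘
  ≤𝟘⇒≡𝟘 a≤𝟘 = ≤-antisym a≤𝟘 (𝟘-least _)

  ⋁-empty : (g : ⊥ → Carrier) → ⋁ g ≡ 𝟘
  ⋁-empty g = ≤𝟘⇒≡𝟘 (⋁-least g 𝟘 (λ ()))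

module Maps {c₁ ℓ₁ c₂ ℓ₂ ι : Level} (X : Quantale c₁ ℓ₁ ι) (Y : Quantale c₂ ℓ₂ ι) where
  private
    module X = Quantale X
    module Y = Quantale Y
    module X𝟘 = QuantaleBottom X
    module Y𝟘 = QuantaleBottom Y

  join-preserving-𝟘 : {f : X.Carrier → Y.Carrier} → JoinPreserving X Y f → f X.𝟘 ≡ Y.𝟘
  join-preserving-𝟘 {f} preserves = trans (preserves {I = ⊥} (λ ())) (Y𝟘.⋁-empty (f ∘ λ ()))

  order-reflecting-𝟘 : {f : X.Carrier → Y.Carrier} →
                       (∀ a b → f a Y.≤ f b → a X.≤ b) →
                       ∀ a → f a ≡ Y.𝟘 → a ≡ X.𝟘
  order-reflecting-𝟘 {f} reflects a fa≡𝟘 =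
    X𝟘.≤𝟘⇒≡𝟘 (reflects a X.𝟘 (subst (Y._≤ f X.𝟘) (sym fa≡𝟘) (Y𝟘.𝟘-least (f X.𝟘))))

  adjunction-unit : {f! : Y.Carrier → X.Carrier} {f : X.Carrier → Y.Carrier} →
                    IsLeftAdjoint X Y f! f → ∀ y → y Y.≤ f (f! y)
  adjunction-unit adj y = proj₁ (adj y _) X.≤-refl

module Transfer {c₁ ℓ₁ c₂ ℓ₂ ι : Level} (X : Quantale c₁ ℓ₁ ι) (Y : Quantale c₂ ℓ₂ ι)
         {f : Quantale.Carrier X → Quantale.Carrier Y} (emb : IsStrictGeometricEmbedding X Y f)
         {f! : Quantale.Carrier Y → Quantale.Carrier X} (adj : IsLeftAdjoint X Y f! f)
         (∇S : Quantale.Carrier X → Quantale.Carrier X) where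
  private
    module X = Quantale X
    module Y = Quantale Y
    module Y𝟘 = QuantaleBottom Y
  open Maps X Y
  open IsStrictGeometricEmbedding emb

  -- (F) transfers: y ≤ f (f! y) ≤ f (∇S (f! y)).
  transfer-F : SatisfiesF X ∇S → SatisfiesF Y (f ∘ ∇S ∘ f!)
  transfer-F inflationary y =
    Y.≤-trans (adjunction-unit adj y) (proj₁ (order-embedding _ _) (inflationary (f! y)))

  -- (wF) transfers: f (∇S (f! y)) = 𝟘 forces f! y = 𝟘, and then y ≤ f 𝟘 = 𝟘.
  transfer-wF : SatisfiesWF X ∇S → SatisfiesWF Y (f ∘ ∇S ∘ f!)
  transfer-wF faithful y f∇f!y≡𝟘 = Y𝟘.≤𝟘⇒≡𝟘 y≤𝟘
    where
      f!y≡𝟘 : f! y ≡ X.𝟘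
      f!y≡𝟘 = faithful (f! y) (order-reflecting-𝟘 (λ a b → proj₂ (order-embedding a b)) _ f∇f!y≡𝟘)
      y≤𝟘 : y Y.≤ Y.𝟘
      y≤𝟘 = subst (y Y.≤_) (trans (cong f f!y≡𝟘) (join-preserving-𝟘 {f} join-preserving))
                  (adjunction-unit adj y)

lemma8p9 : {c₁ ℓ₁ c₂ ℓ₂ ι : Level} (X : Quantale c₁ ℓ₁ ι) (∇S : Quantale.Carrier X → Quantale.Carrier X)
    → IsSpacetime X ∇S
    → (Y : Quantale c₂ ℓ₂ ι)
    → (f : Quantale.Carrier X → Quantale.Carrier Y)
    → IsStrictGeometricEmbedding X Y f
    → (f! : Quantale.Carrier Y → Quantale.Carrier X)
    → IsLeftAdjoint X Y f! f
    → (SatisfiesF X ∇S → SatisfiesF Y (f ∘ ∇S ∘ f!))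
    × (SatisfiesWF X ∇S → SatisfiesWF Y (f ∘ ∇S ∘ f!))
lemma8p9 X ∇S _ Y f emb f! adj = transfer-F , transfer-wF
  where open Transfer X Y emb adj ∇S
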